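{- If $F'$ admits a resolution refutation of width $w$ and depth $d$, then $F$ admits a resolution refutation of index-width $O(w)$ and depth $O(d\log|\Sigma|)$.
   Context: Let $\Sigma$ be a finite alphabet and consider a system of constraints on strings $s\in\Sigma^n$, each depending on $O(1)$ indices. $F$ is the CNF obtained by introducing $m=\lceil\log_2|\Sigma|\rceil$ Boolean variables per index $i\in[n]$, fixing an injective encoding $\pi\colon\Sigma\to\{0,1\}^m$, and encoding each constraint as a CNF over the variables of the indices it involves. The index-width of a clause is the number of indices $i\in[n]$ whose variables occur in it, and the index-width of a formula or refutation is the maximum index-width of its clauses; let $k$ be the index-width of $F$. The CNF $F'$ has a variable $y_D$ for every clause $D$ over the variables of $F$ of index-width at most $k$, and consists of: the unit clause $y_D$ for each clause $D$ of $F$; for every variable $x$ of $F$ the clauses $y_x\lor y_{\neg x}$ and $\neg y_x\lor\neg y_{\neg x}$; and for all clauses $A,B,D$ of index-width at most $k$ with $D=A\lor B$, clauses enforcing $y_D\leftrightarrow(y_A\lor y_B)$. Width of a refutation is maximal clause width; depth is the length of a longest path in the derivation DAG. -}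

module Defs where

open import Data.Nat using (ℕ; zero; suc; _+_; _≤_; _⊔_)
open import Data.Bool using (Bool; true; false; _∨_; if_then_else_)
open import Data.Product using (Σ; _×_; _,_; proj₁; proj₂)
open import Data.Sum using (_⊎_)
open import Data.List using (List; []; _∷_; length)
open import Data.List.Membership.Propositional using (_∈_)
open import Data.Vec using (Vec; []; _∷_; lookup)
open import Data.Fin using (Fin)
open import Relation.Binary.PropositionalEquality using (_≡_; _≢_)

-- A literal is a variable with a sign (true = positive, false = negated).
Lit : Set → Set
Lit V = V × Bool

-- A clause is a set of literals, given by its (decidable) membership
-- function. Clauses are compared extensionally (pointwise).
Clause : Set → Set
Clause V = Lit V → Bool

CNF : Set → Set₁
CNF V = Clause V → Set

_∋ₗ_ : ∀ {V} → Clause V → Lit V → Set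
C ∋ₗ l = C l ≡ true

IsEmpty : ∀ {V} → Clause V → Set
IsEmpty C = ∀ l → C l ≡ false

ListClause : ∀ {V} → Clause V → List (Lit V) → Set
ListClause C L = ∀ l → ((C ∋ₗ l) → l ∈ L) × (l ∈ L → C ∋ₗ l)

Resolvent : ∀ {V} → V → Clause V → Clause V → Clause V → Set
Resolvent x A B C =
  (A ∋ₗ (x , true)) × (B ∋ₗ (x , false)) ×
  (∀ l → ((C ∋ₗ l) → ((A ∋ₗ l) × l ≢ (x , true)) ⊎ ((B ∋ₗ l) × l ≢ (x , false)))
       × (((A ∋ₗ l) × l ≢ (x , true)) ⊎ ((B ∋ₗ l) × l ≢ (x , false)) → C ∋ₗ l))

-- Derivation F ok d C : a resolution derivation of C from F in which every
-- clause satisfies ok, and whose depth (longest path in the derivation,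
-- measured in inference steps) is at most d.  (Unfolding the DAG to a tree
-- preserves both width and depth, so trees suffice.)
data Derivation {V : Set} (F : CNF V) (ok : Clause V → Set) : ℕ → Clause V → Set where
  axiom   : ∀ {d C} → ok C → F C → Derivation F ok d C
  resolve : ∀ {d A B C} (x : V) → ok C →
            Derivation F ok d A → Derivation F ok d B →
            Resolvent x A B C → Derivation F ok (suc d) C

Refutation : ∀ {V} → CNF V → (Clause V → Set) → ℕ → Set
Refutation {V} F ok d = Σ (Clause V) λ C → IsEmpty C × Derivation F ok d C

WidthAtMost : ∀ {V} → ℕ → Clause V → Set
WidthAtMost {V} w C = Σ (List (Lit V)) λ L → (length L ≤ w) × (∀ l → C ∋ₗ l → l ∈ L)

-- The block-structured variables of F: m Boolean variables per index i ∈ [n]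

Var : ℕ → ℕ → Set
Var n m = Fin n × Fin m

IndexWidthAtMost : ∀ {n m} → ℕ → Clause (Var n m) → Set
IndexWidthAtMost {n} {m} w C =
  Σ (List (Fin n)) λ I → (length I ≤ w) ×
    (∀ (i : Fin n) (j : Fin m) (b : Bool) → C ((i , j) , b) ≡ true → i ∈ I)

-- Canonical representation of a clause over Var n m: entry (i , j) is the
-- pair (x_ij ∈ D , ¬x_ij ∈ D).  Propositional equality is set equality.
CClause : ℕ → ℕ → Set
CClause n m = Vec (Vec (Bool × Bool) m) n

⟦_⟧ : ∀ {n m} → CClause n m → Clause (Var n m)
⟦ D ⟧ ((i , j) , true)  = proj₁ (lookup (lookup D i) j)
⟦ D ⟧ ((i , j) , false) = proj₂ (lookup (lookup D i) j)

blockUsed : ∀ {m} → Vec (Bool × Bool) m → Bool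
blockUsed [] = false
blockUsed ((p , q) ∷ r) = p ∨ q ∨ blockUsed r

indexWidth : ∀ {n m} → CClause n m → ℕ
indexWidth [] = 0
indexWidth (r ∷ D) = (if blockUsed r then 1 else 0) + indexWidth D

formulaIndexWidth : ∀ {n m} → List (CClause n m) → ℕ
formulaIndexWidth [] = 0
formulaIndexWidth (D ∷ F) = indexWidth D ⊔ formulaIndexWidth F

asCNF : ∀ {n m} → List (CClause n m) → CNF (Var n m)
asCNF F C = Σ _ λ D → (D ∈ F) × (∀ l → C l ≡ ⟦ D ⟧ l)

YVar : ℕ → ℕ → ℕ → Set
YVar n m k = Σ (CClause n m) λ D → indexWidth D ≤ k

data F′ {n m : ℕ} (F : List (CClause n m)) :
       Clause (YVar n m (formulaIndexWidth F)) → Set where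
  unitAx : ∀ {C} (D : YVar n m (formulaIndexWidth F)) → proj₁ D ∈ F →
           ListClause C ((D , true) ∷ []) → F′ F C
  -- y_x ∨ y_¬x  (P is the unit clause x, N the unit clause ¬x)
  litPos : ∀ {C} (x : Var n m) (P N : YVar n m (formulaIndexWidth F)) →
           ListClause ⟦ proj₁ P ⟧ ((x , true) ∷ []) →
           ListClause ⟦ proj₁ N ⟧ ((x , false) ∷ []) →
           ListClause C ((P , true) ∷ (N , true) ∷ []) → F′ F C
  litNeg : ∀ {C} (x : Var n m) (P N : YVar n m (formulaIndexWidth F)) →
           ListClause ⟦ proj₁ P ⟧ ((x , true) ∷ []) →
           ListClause ⟦ proj₁ N ⟧ ((x , false) ∷ []) →
           ListClause C ((P , false) ∷ (N , false) ∷ []) → F′ F C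
  -- y_D ↔ (y_A ∨ y_B) for D = A ∨ B, as the three clauses
  -- ¬y_D ∨ y_A ∨ y_B ,  ¬y_A ∨ y_D ,  ¬y_B ∨ y_D
  orDef₁ : ∀ {C} (A B D : YVar n m (formulaIndexWidth F)) →
           (∀ l → ⟦ proj₁ D ⟧ l ≡ (⟦ proj₁ A ⟧ l ∨ ⟦ proj₁ B ⟧ l)) →
           ListClause C ((D , false) ∷ (A , true) ∷ (B , true) ∷ []) → F′ F C
  orDef₂ : ∀ {C} (A B D : YVar n m (formulaIndexWidth F)) →
           (∀ l → ⟦ proj₁ D ⟧ l ≡ (⟦ proj₁ A ⟧ l ∨ ⟦ proj₁ B ⟧ l)) →
           ListClause C ((A , false) ∷ (D , true) ∷ []) → F′ F C
  orDef₃ : ∀ {C} (A B D : YVar n m (formulaIndexWidth F)) →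
           (∀ l → ⟦ proj₁ D ⟧ l ≡ (⟦ proj₁ A ⟧ l ∨ ⟦ proj₁ B ⟧ l)) →
           ListClause C ((B , false) ∷ (D , true) ∷ []) → F′ F C

{-# OPTIONS --safe #-}
module Submission where

-- Walk a refutation of F′ upwards from the empty clause, carrying a partial assignment ρ to the
-- variables of F (encoded as the clause E it falsifies) such that the current F′-clause is false
-- under y_D ↦ "ρ satisfies D".  An F′-axiom false under this assignment can only be a unit clause
-- y_D with D ∈ F falsified by ρ, so a subclause of E is an axiom of F.  At a resolution step on
-- y_D, first branch on all ≤ K·m variables of the ≤ K blocks of D, with one resolution step per
-- variable; at each leaf ρ decides D, so one premise is false, and ρ is restricted to the ≤ w·K
-- blocks that premise mentions.  Hence all clauses have index-width ≤ w·K + K ≤ 2K·w, and each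
-- step of the F′-refutation costs depth ≤ 2K·(m + 1).

open import Defs
open import Data.Bool using (Bool; true; false; not; _∧_; _∨_; if_then_else_)
import Data.Bool as Bool
open import Data.Bool.Properties using (∨-zeroʳ)
open import Data.Empty using (⊥; ⊥-elim)
open import Data.Fin using (Fin; zero; suc)
import Data.Fin as Fin
open import Data.List using (List; []; _∷_; length; _++_; map; concatMap; allFin; cartesianProduct)
open import Data.List.Properties using (length-++; length-map; length-tabulate)
open import Data.List.Membership.Propositional using (_∈_; lose)
open import Data.List.Membership.Propositional.Properties
  using (∈-++⁺ˡ; ∈-++⁺ʳ; ∈-map⁺; ∈-allFin; ∈-concatMap⁺; ∈-cartesianProduct⁺; ∈-cartesianProduct⁻)
import Data.List.Membership.DecPropositional as DecMembership
open import Data.List.Relation.Unary.All using (All; []; _∷_; tabulate) renaming (lookup to lookupAll)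
open import Data.List.Relation.Unary.Any using (here; there; any?; satisfied)
open import Data.Nat using (ℕ; zero; suc; _+_; _*_; _≤_; z≤n; s≤s)
open import Data.Nat.Logarithm using (⌈log₂_⌉)
open import Data.Nat.Properties
open import Data.Product using (∃; ∃-syntax; _×_; _,_; proj₁; proj₂)
open import Data.Product.Properties using (≡-dec)
open import Data.Sum using (_⊎_; inj₁; inj₂; [_,_]; [_,_]′; swap)
import Data.Sum as Sum
import Data.Vec.Properties as Vec
open import Data.Vec using (Vec; []; _∷_; lookup)
open import Function using (id; _∘_)
open import Relation.Binary.Definitions using (DecidableEquality)
open import Relation.Binary.PropositionalEquality using (_≡_; _≢_; refl; sym; trans; cong; cong₂)
open import Relation.Nullary using (Dec; yes; no; does; ¬_)
open import Relation.Nullary.Decidable using (dec-true; map′; _×-dec_; _⊎-dec_)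

deepen : ∀ {V} {F : CNF V} {ok d d′ C} → d ≤ d′ → Derivation F ok d C → Derivation F ok d′ C
deepen _       (axiom okC C∈F)        = axiom okC C∈F
deepen (s≤s p) (resolve x okC δ₁ δ₂ r) = resolve x okC (deepen p δ₁) (deepen p δ₂) r

root-ok : ∀ {V} {F : CNF V} {ok d C} → Derivation F ok d C → ok C
root-ok (axiom okC _)         = okC
root-ok (resolve _ okC _ _ _) = okC

WidthAtMost-∋ : ∀ {V w} {C : Clause V} {l} → WidthAtMost w C → C ∋ₗ l → 1 ≤ w
WidthAtMost-∋ (_ ∷ _ , |L|≤w , _) _ = ≤-trans (s≤s z≤n) |L|≤w
WidthAtMost-∋ {l = l} ([] , _ , C⊆L) l∈C with () ← C⊆L l l∈C

Every : ∀ {V} → (Lit V → Set) → Clause V → Set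
Every P C = ∀ l → C ∋ₗ l → P l

IsEmpty-Every : ∀ {V P} {C : Clause V} → IsEmpty C → Every P C
IsEmpty-Every C-empty l l∈C with () ← trans (sym l∈C) (C-empty l)

ListClause-∋ : ∀ {V} {C : Clause V} {L l} → ListClause C L → l ∈ L → C ∋ₗ l
ListClause-∋ C≈L l∈L = proj₂ (C≈L _) l∈L

ListClause-unit : ∀ {V} {C : Clause V} {l} l′ → ListClause C (l ∷ []) → C ∋ₗ l′ → l′ ≡ l
ListClause-unit l′ C≈l l′∈C with proj₁ (C≈l l′) l′∈C
... | here l′≡l = l′≡l

dec-true⁻ : ∀ {A : Set} (a? : Dec A) → does a? ≡ true → A
dec-true⁻ (yes a) _ = a

module Resolvents {V : Set} (_≟_ : DecidableEquality V) where

  _≟ₗ_ : DecidableEquality (Lit V)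
  _≟ₗ_ = ≡-dec _≟_ Bool._≟_

  resolvent-left : ∀ {x A B C} P → Resolvent x A B C → Every P C → P (x , true) → Every P A
  resolvent-left {x} P (_ , _ , C≈) C-P x-P l l∈A with l ≟ₗ (x , true)
  ... | yes refl = x-P
  ... | no l≢x   = C-P l (proj₂ (C≈ l) (inj₁ (l∈A , l≢x)))

  resolvent-right : ∀ {x A B C} P → Resolvent x A B C → Every P C → P (x , false) → Every P B
  resolvent-right {x} P (_ , _ , C≈) C-P x̄-P l l∈B with l ≟ₗ (x , false)
  ... | yes refl = x̄-P
  ... | no l≢x̄   = C-P l (proj₂ (C≈ l) (inj₂ (l∈B , l≢x̄)))

module Clauses {V : Set} (_≟_ : DecidableEquality V) where

  open Resolvents _≟_ using (_≟ₗ_)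

  neg : Lit V → Lit V
  neg (x , b) = x , not b

  infix 4 _⊆_
  _⊆_ : Clause V → Clause V → Set
  A ⊆ B = Every (B ∋ₗ_) A

  ⊆-refl : ∀ {A} → A ⊆ A
  ⊆-refl _ l∈A = l∈A

  ⊆-trans : ∀ {A B C} → A ⊆ B → B ⊆ C → A ⊆ C
  ⊆-trans A⊆B B⊆C l l∈A = B⊆C l (A⊆B l l∈A)

  ∅ : Clause V
  ∅ _ = false

  ⁅_⁆ : Lit V → Clause V
  ⁅ l ⁆ l′ = does (l′ ≟ₗ l)

  infixl 6 _∪_
  infixl 7 _∩_ _∖_
  _∪_ _∩_ : Clause V → Clause V → Clause V
  (A ∪ B) l = A l ∨ B l
  (A ∩ B) l = A l ∧ B l

  _∖_ : Clause V → Lit V → Clause V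
  (A ∖ l) l′ = A l′ ∧ not (does (l′ ≟ₗ l))

  ⊆∅⇒IsEmpty : ∀ {C} → C ⊆ ∅ → IsEmpty C
  ⊆∅⇒IsEmpty {C} C⊆∅ l with C l in l∈C
  ... | true  with () ← C⊆∅ l l∈C
  ... | false = refl

  ∪-∋⁻ : ∀ A B l → (A ∪ B) ∋ₗ l → A ∋ₗ l ⊎ B ∋ₗ l
  ∪-∋⁻ A B l l∈A∪B with A l
  ... | true  = inj₁ refl
  ... | false = inj₂ l∈A∪B

  ∪-⊇ˡ : ∀ A B → A ⊆ A ∪ B
  ∪-⊇ˡ A B l l∈A rewrite l∈A = refl

  ∪-⊇ʳ : ∀ A B → B ⊆ A ∪ B
  ∪-⊇ʳ A B l l∈B rewrite l∈B = ∨-zeroʳ (A l)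

  ∪-⊆ : ∀ {A B E} → A ⊆ E → B ⊆ E → A ∪ B ⊆ E
  ∪-⊆ {A} {B} A⊆E B⊆E l l∈A∪B = [ A⊆E l , B⊆E l ] (∪-∋⁻ A B l l∈A∪B)

  ∩-⊆ˡ : ∀ A B → A ∩ B ⊆ A
  ∩-⊆ˡ A B l l∈A∩B with A l
  ... | true = refl

  ∩-⊆ʳ : ∀ A B → A ∩ B ⊆ B
  ∩-⊆ʳ A B l l∈A∩B with A l
  ... | true = l∈A∩B

  ∩-∋⁺ : ∀ A B l → A ∋ₗ l → B ∋ₗ l → (A ∩ B) ∋ₗ l
  ∩-∋⁺ A B l l∈A l∈B rewrite l∈A | l∈B = refl

  ∈⁅⁆ : ∀ l → ⁅ l ⁆ ∋ₗ l
  ∈⁅⁆ l = dec-true (l ≟ₗ l) refl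

  ⁅⁆-∋⁻ : ∀ {l} l′ → ⁅ l ⁆ ∋ₗ l′ → l′ ≡ l
  ⁅⁆-∋⁻ {l} l′ = dec-true⁻ (l′ ≟ₗ l)

  ⁅⁆-⊆ : ∀ {E l} → E ∋ₗ l → ⁅ l ⁆ ⊆ E
  ⁅⁆-⊆ l∈E l′ l′∈⁅l⁆ with refl ← ⁅⁆-∋⁻ l′ l′∈⁅l⁆ = l∈E

  ∖-∋⁻ : ∀ A {l} l′ → (A ∖ l) ∋ₗ l′ → A ∋ₗ l′ × l′ ≢ l
  ∖-∋⁻ A {l} l′ l′∈A∖l with A l′ | l′ ≟ₗ l
  ... | true | no l′≢l = refl , l′≢l

  ∖-∋⁺ : ∀ {A l l′} → A ∋ₗ l′ → l′ ≢ l → (A ∖ l) ∋ₗ l′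
  ∖-∋⁺ {l = l} {l′} l′∈A l′≢l rewrite l′∈A with l′ ≟ₗ l
  ... | yes l′≡l = ⊥-elim (l′≢l l′≡l)
  ... | no _     = refl

  ∪⁅⁆-∋⁻ : ∀ E {l} l′ → (E ∪ ⁅ l ⁆) ∋ₗ l′ → l′ ≢ l → E ∋ₗ l′
  ∪⁅⁆-∋⁻ E {l} l′ l′∈E∪l l′≢l = [ id , ⊥-elim ∘ l′≢l ∘ ⁅⁆-∋⁻ l′ ] (∪-∋⁻ E ⁅ l ⁆ l′ l′∈E∪l)

  ⊆∪⁅⁆⇒⊆ : ∀ {S E l} → S ⊆ E ∪ ⁅ l ⁆ → ¬ S ∋ₗ l → S ⊆ E
  ⊆∪⁅⁆⇒⊆ {E = E} S⊆E∪l l∉S l′ l′∈S = ∪⁅⁆-∋⁻ E l′ (S⊆E∪l l′ l′∈S) λ { refl → l∉S l′∈S }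

  ∖-⊆ : ∀ {S E l} → S ⊆ E ∪ ⁅ l ⁆ → S ∖ l ⊆ E
  ∖-⊆ {S} {E} S⊆E∪l l′ l′∈S∖l =
    let l′∈S , l′≢l = ∖-∋⁻ S l′ l′∈S∖l in ∪⁅⁆-∋⁻ E l′ (S⊆E∪l l′ l′∈S) l′≢l

  resolventOn : V → Clause V → Clause V → Clause V
  resolventOn x A B = A ∖ (x , true) ∪ B ∖ (x , false)

  resolventOn-Resolvent : ∀ {x A B} → A ∋ₗ (x , true) → B ∋ₗ (x , false) →
                          Resolvent x A B (resolventOn x A B)
  resolventOn-Resolvent {x} {A} {B} x∈A x̄∈B = x∈A , x̄∈B , λ l →
      Sum.map (∖-∋⁻ A l) (∖-∋⁻ B l) ∘ ∪-∋⁻ (A ∖ (x , true)) (B ∖ (x , false)) l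
    , [ (λ (l∈A , l≢x) → ∪-⊇ˡ (A ∖ (x , true)) (B ∖ (x , false)) l (∖-∋⁺ {A} l∈A l≢x))
      , (λ (l∈B , l≢x̄) → ∪-⊇ʳ (A ∖ (x , true)) (B ∖ (x , false)) l (∖-∋⁺ {B} l∈B l≢x̄)) ]

  NonTautological : Clause V → Set
  NonTautological E = ∀ x → E ∋ₗ (x , true) → E ∋ₗ (x , false) → ⊥

  NonTautological-neg : ∀ E → NonTautological E → ∀ l → E ∋ₗ l → E ∋ₗ neg l → ⊥
  NonTautological-neg E nt (x , true)  l∈E l̄∈E = nt x l∈E l̄∈E
  NonTautological-neg E nt (x , false) l∈E l̄∈E = nt x l̄∈E l∈E

  NonTautological-⊆ : ∀ {S} E → S ⊆ E → NonTautological E → NonTautological S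
  NonTautological-⊆ E S⊆E nt x x∈S x̄∈S = nt x (S⊆E _ x∈S) (S⊆E _ x̄∈S)

  NonTautological-∪⁅⁆ : ∀ {E x b} → NonTautological E → ¬ E ∋ₗ neg (x , b) →
                        NonTautological (E ∪ ⁅ x , b ⁆)
  NonTautological-∪⁅⁆ {E} {x} {b} nt x̄∉E y y∈ ȳ∈
    with ∪-∋⁻ E ⁅ x , b ⁆ (y , true) y∈ | ∪-∋⁻ E ⁅ x , b ⁆ (y , false) ȳ∈
  ... | inj₁ y∈E | inj₁ ȳ∈E = nt y y∈E ȳ∈E
  ... | inj₁ y∈E | inj₂ ȳ∈l with refl ← ⁅⁆-∋⁻ (y , false) ȳ∈l = x̄∉E y∈E
  ... | inj₂ y∈l | inj₁ ȳ∈E with refl ← ⁅⁆-∋⁻ (y , true) y∈l = x̄∉E ȳ∈E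
  ... | inj₂ y∈l | inj₂ ȳ∈l with refl ← ⁅⁆-∋⁻ (y , true) y∈l | () ← ⁅⁆-∋⁻ (y , false) ȳ∈l

  Decided : Clause V → V → Set
  Decided E x = E ∋ₗ (x , true) ⊎ E ∋ₗ (x , false)

  Decides : List V → Clause V → Set
  Decides xs E = All (Decided E) xs

  decided? : ∀ E x → Decided E x ⊎ (¬ E ∋ₗ (x , true) × ¬ E ∋ₗ (x , false))
  decided? E x with E (x , true) Bool.≟ true | E (x , false) Bool.≟ true
  ... | yes x∈E | _        = inj₁ (inj₁ x∈E)
  ... | no _    | yes x̄∈E  = inj₁ (inj₂ x̄∈E)
  ... | no x∉E  | no x̄∉E   = inj₂ (x∉E , x̄∉E)

  Decided-⊆ : ∀ {E E′ x} → E ⊆ E′ → Decided E x → Decided E′ x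
  Decided-⊆ E⊆E′ = Sum.map (E⊆E′ _) (E⊆E′ _)

  Decided-∋ : ∀ {E x} b → E ∋ₗ (x , b) → Decided E x
  Decided-∋ true  = inj₁
  Decided-∋ false = inj₂

  Decided-sign : ∀ {E x} → Decided E x → ∀ b → E ∋ₗ (x , b) ⊎ E ∋ₗ neg (x , b)
  Decided-sign dec true  = dec
  Decided-sign dec false = swap dec

  -- A clause E stands for the partial assignment falsifying it: D is falsified by it iff D ⊆ E.
  SatisfiedUnder : Clause V → Clause V → Set
  SatisfiedUnder E D = ∃ λ l → D ∋ₗ l × E ∋ₗ neg l

  satisfiedAt? : ∀ E D x → Dec (∃ λ b → D ∋ₗ (x , b) × E ∋ₗ neg (x , b))
  satisfiedAt? E D x =
    map′ [ (true ,_) , (false ,_) ] (λ { (true , s) → inj₁ s ; (false , s) → inj₂ s })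
         ((D (x , true) Bool.≟ true ×-dec E (x , false) Bool.≟ true) ⊎-dec
          (D (x , false) Bool.≟ true ×-dec E (x , true) Bool.≟ true))

  satisfied-or-falsified : ∀ {E D} xs → (∀ x b → D ∋ₗ (x , b) → x ∈ xs) → Decides xs E →
                           SatisfiedUnder E D ⊎ D ⊆ E
  satisfied-or-falsified {E} {D} xs vars dec with any? (satisfiedAt? E D) xs
  ... | yes sat = let x , b , s = satisfied sat in inj₁ ((x , b) , s)
  ... | no ¬sat = inj₂ λ { (x , b) l∈D →
        [ id , (λ l̄∈E → ⊥-elim (¬sat (lose (vars x b l∈D) (b , l∈D , l̄∈E)))) ]
          (Decided-sign {E} {x} (lookupAll dec (vars x b l∈D)) b) }

  module Subclauses (F : CNF V) (ok : Clause V → Set) where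

    DerivesSubclause : ℕ → Clause V → Set
    DerivesSubclause d E = ∃ λ S → S ⊆ E × Derivation F ok d S

    deepenSub : ∀ {d d′ E} → d ≤ d′ → DerivesSubclause d E → DerivesSubclause d′ E
    deepenSub d≤d′ (S , S⊆E , δ) = S , S⊆E , deepen d≤d′ δ

    weakenSub : ∀ {d E E′} → E ⊆ E′ → DerivesSubclause d E → DerivesSubclause d E′
    weakenSub E⊆E′ (S , S⊆E , δ) = S , ⊆-trans S⊆E E⊆E′ , δ

    resolveSub : ∀ {d E} x → (∀ {S} → S ⊆ E → ok S) →
                 DerivesSubclause d (E ∪ ⁅ x , true ⁆) → DerivesSubclause d (E ∪ ⁅ x , false ⁆) →
                 DerivesSubclause (suc d) E
    resolveSub x ok-E (S₁ , S₁⊆ , δ₁) (S₂ , S₂⊆ , δ₂)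
      with S₁ (x , true) Bool.≟ true | S₂ (x , false) Bool.≟ true
    ... | no x∉S₁  | _        = S₁ , ⊆∪⁅⁆⇒⊆ S₁⊆ x∉S₁ , deepen (n≤1+n _) δ₁
    ... | yes _    | no x̄∉S₂  = S₂ , ⊆∪⁅⁆⇒⊆ S₂⊆ x̄∉S₂ , deepen (n≤1+n _) δ₂
    ... | yes x∈S₁ | yes x̄∈S₂ =
      resolventOn x S₁ S₂ , R⊆E , resolve x (ok-E R⊆E) δ₁ δ₂ (resolventOn-Resolvent x∈S₁ x̄∈S₂)
      where
      R⊆E : resolventOn x S₁ S₂ ⊆ _
      R⊆E = ∪-⊆ (∖-⊆ S₁⊆) (∖-⊆ S₂⊆)

    -- A decision tree branching on the variables of xs; U bounds every clause occurring in it.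
    decideAll : ∀ {d U} → (∀ {S} → S ⊆ U → ok S) →
                ∀ xs → All (λ x → ∀ b → U ∋ₗ (x , b)) xs →
                ∀ {E} → E ⊆ U → NonTautological E →
                (∀ {E′} → E ⊆ E′ → NonTautological E′ → Decides xs E′ → DerivesSubclause d E′) →
                DerivesSubclause (length xs + d) E
    decideAll ok-U [] [] E⊆U nt leaf = leaf ⊆-refl nt []
    decideAll ok-U (x ∷ xs) (x∈U ∷ xs∈U) {E} E⊆U nt leaf with decided? E x
    ... | inj₁ x-dec =
      deepenSub (n≤1+n _) (decideAll ok-U xs xs∈U E⊆U nt λ E⊆E′ nt′ dec →
        leaf E⊆E′ nt′ (Decided-⊆ E⊆E′ x-dec ∷ dec))
    ... | inj₂ (x∉E , x̄∉E) =
      resolveSub x (λ S⊆E → ok-U (⊆-trans S⊆E E⊆U)) (branch true x̄∉E) (branch false x∉E)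
      where
      branch : ∀ b → ¬ E ∋ₗ neg (x , b) → DerivesSubclause (length xs + _) (E ∪ ⁅ x , b ⁆)
      branch b x̄∉E =
        decideAll ok-U xs xs∈U (∪-⊆ E⊆U (⁅⁆-⊆ (x∈U b))) (NonTautological-∪⁅⁆ {E} nt x̄∉E)
          λ {E′} E∪x⊆E′ nt′ dec →
            leaf (⊆-trans (∪-⊇ˡ E ⁅ x , b ⁆) E∪x⊆E′) nt′
                 (Decided-∋ {E′} b (E∪x⊆E′ (x , b) (∪-⊇ʳ E ⁅ x , b ⁆ (x , b) (∈⁅⁆ (x , b)))) ∷ dec)

length-cartesianProduct : ∀ {A B : Set} (xs : List A) (ys : List B) →
                          length (cartesianProduct xs ys) ≡ length xs * length ys
length-cartesianProduct []       ys = refl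
length-cartesianProduct (x ∷ xs) ys =
  trans (length-++ (map (x ,_) ys))
        (cong₂ _+_ (length-map (x ,_) ys) (length-cartesianProduct xs ys))

blockUsed-lookup : ∀ {m} (r : Vec (Bool × Bool) m) j →
                   proj₁ (lookup r j) ≡ true ⊎ proj₂ (lookup r j) ≡ true → blockUsed r ≡ true
blockUsed-lookup ((p , q) ∷ r) zero    (inj₁ p≡true) rewrite p≡true = refl
blockUsed-lookup ((p , q) ∷ r) zero    (inj₂ q≡true) rewrite q≡true = ∨-zeroʳ p
blockUsed-lookup ((p , q) ∷ r) (suc j) used rewrite blockUsed-lookup r j used =
  trans (cong (p ∨_) (∨-zeroʳ q)) (∨-zeroʳ p)

index : ∀ {n m} → Lit (Var n m) → Fin n
index ((i , _) , _) = i

indices : ∀ {n m} → CClause n m → List (Fin n)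
indices []      = []
indices (r ∷ D) = if blockUsed r then zero ∷ map suc (indices D) else map suc (indices D)

length-indices : ∀ {n m} (D : CClause n m) → length (indices D) ≡ indexWidth D
length-indices []      = refl
length-indices (r ∷ D) with blockUsed r
... | true  = cong suc (trans (length-map suc (indices D)) (length-indices D))
... | false = trans (length-map suc (indices D)) (length-indices D)

blockUsed⇒∈indices : ∀ {n m} (D : CClause n m) i → blockUsed (lookup D i) ≡ true → i ∈ indices D
blockUsed⇒∈indices (r ∷ D) zero    used rewrite used = here refl
blockUsed⇒∈indices (r ∷ D) (suc i) used with blockUsed r
... | true  = there (∈-map⁺ suc (blockUsed⇒∈indices D i used))
... | false = ∈-map⁺ suc (blockUsed⇒∈indices D i used)

index-∈-indices : ∀ {n m} (D : CClause n m) l → ⟦ D ⟧ ∋ₗ l → index l ∈ indices D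
index-∈-indices D ((i , j) , true)  l∈D =
  blockUsed⇒∈indices D i (blockUsed-lookup (lookup D i) j (inj₁ l∈D))
index-∈-indices D ((i , j) , false) l∈D =
  blockUsed⇒∈indices D i (blockUsed-lookup (lookup D i) j (inj₂ l∈D))

blockVars : ∀ {n} m → List (Fin n) → List (Var n m)
blockVars m I = cartesianProduct I (allFin m)

length-blockVars : ∀ {n} m (I : List (Fin n)) → length (blockVars m I) ≡ length I * m
length-blockVars m I =
  trans (length-cartesianProduct I (allFin m)) (cong (length I *_) (length-tabulate id))

module Indexed {n m : ℕ} where

  open Clauses {Var n m} (≡-dec Fin._≟_ Fin._≟_) public
  open DecMembership (Fin._≟_ {n}) using (_∈?_)

  onIndices : List (Fin n) → Clause (Var n m)
  onIndices I l = does (index l ∈? I)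

  onIndices-∋⁻ : ∀ I l → onIndices I ∋ₗ l → index l ∈ I
  onIndices-∋⁻ I l = dec-true⁻ (index l ∈? I)

  onIndices-∋⁺ : ∀ I l → index l ∈ I → onIndices I ∋ₗ l
  onIndices-∋⁺ I l = dec-true (index l ∈? I)

  onIndices-++ˡ : ∀ I J → onIndices I ⊆ onIndices (I ++ J)
  onIndices-++ˡ I J l = onIndices-∋⁺ (I ++ J) l ∘ ∈-++⁺ˡ ∘ onIndices-∋⁻ I l

  IndexWidthAtMost-onIndices : ∀ {w S} I → length I ≤ w → S ⊆ onIndices I → IndexWidthAtMost w S
  IndexWidthAtMost-onIndices I |I|≤w S⊆I =
    I , |I|≤w , λ i j b l∈S → onIndices-∋⁻ I ((i , j) , b) (S⊆I ((i , j) , b) l∈S)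

  blockVars-in-onIndices : ∀ I J → All (λ x → ∀ b → onIndices (J ++ I) ∋ₗ (x , b)) (blockVars m I)
  blockVars-in-onIndices I J = tabulate λ {x} x∈I×m b →
    onIndices-∋⁺ (J ++ I) (x , b) (∈-++⁺ʳ J (proj₁ (∈-cartesianProduct⁻ I (allFin m) x∈I×m)))

  var-∈-blockVars : ∀ (D : CClause n m) x b → ⟦ D ⟧ ∋ₗ (x , b) → x ∈ blockVars m (indices D)
  var-∈-blockVars D x b l∈D = ∈-cartesianProduct⁺ (index-∈-indices D (x , b) l∈D) (∈-allFin (proj₂ x))

module Simulation {n m : ℕ} (F : List (CClause n m)) (K : ℕ) (k≤K : formulaIndexWidth F ≤ K)
                  (w : ℕ) where

  open Indexed {n} {m}
  open Subclauses (asCNF F) (IndexWidthAtMost ((K + K) * w))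

  Y : Set
  Y = YVar n m (formulaIndexWidth F)

  _≟Y_ : DecidableEquality Y
  _≟Y_ = ≡-dec (Vec.≡-dec (Vec.≡-dec (≡-dec Bool._≟_ Bool._≟_))) (λ p q → yes (≤-irrelevant p q))

  open Resolvents _≟Y_ using (resolvent-left; resolvent-right)

  T : ℕ
  T = (K + K) * suc m

  length-indices-≤ : ∀ (D : Y) → length (indices (proj₁ D)) ≤ K
  length-indices-≤ (D , D≤k) = ≤-trans (≤-reflexive (length-indices D)) (≤-trans D≤k k≤K)

  wK≤[K+K]w : w * K ≤ (K + K) * w
  wK≤[K+K]w = ≤-trans (≤-reflexive (*-comm w K)) (*-monoˡ-≤ w (m≤m+n K K))

  wK+K≤[K+K]w : 1 ≤ w → w * K + K ≤ (K + K) * w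
  wK+K≤[K+K]w 1≤w = begin
    w * K + K      ≡⟨ cong₂ _+_ (*-comm w K) (sym (*-identityʳ K)) ⟩
    K * w + K * 1  ≤⟨ +-monoʳ-≤ (K * w) (*-monoʳ-≤ K 1≤w) ⟩
    K * w + K * w  ≡⟨ *-distribʳ-+ w K K ⟨
    (K + K) * w    ∎
    where open ≤-Reasoning

  step-depth : ∀ (D : Y) d → length (blockVars m (indices (proj₁ D))) + d * T ≤ suc d * T
  step-depth D d = +-monoˡ-≤ (d * T) (begin
    length (blockVars m (indices (proj₁ D)))  ≡⟨ length-blockVars m (indices (proj₁ D)) ⟩
    length (indices (proj₁ D)) * m            ≤⟨ *-mono-≤ (length-indices-≤ D) (n≤1+n m) ⟩
    K * suc m                                 ≤⟨ *-monoˡ-≤ (suc m) (m≤m+n K K) ⟩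
    T                                         ∎)
    where open ≤-Reasoning

  -- The variable y_D of F′ is read as "D is true under the assignment falsifying E".
  LiftedFalse : Clause (Var n m) → Lit Y → Set
  LiftedFalse E ((D , _) , true)  = ⟦ D ⟧ ⊆ E
  LiftedFalse E ((D , _) , false) = SatisfiedUnder E ⟦ D ⟧

  LiftedFalse-⊆ : ∀ {E E′ C} → E ⊆ E′ → Every (LiftedFalse E) C → Every (LiftedFalse E′) C
  LiftedFalse-⊆ E⊆E′ C-false (_ , true)  l∈C = ⊆-trans (C-false _ l∈C) E⊆E′
  LiftedFalse-⊆ E⊆E′ C-false (_ , false) l∈C =
    let l , l∈D , l̄∈E = C-false _ l∈C in l , l∈D , E⊆E′ (neg l) l̄∈E

  falsified-axiom : ∀ {E C} → NonTautological E → F′ F C → Every (LiftedFalse E) C →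
                    ∃[ D ] D ∈ F × ⟦ D ⟧ ⊆ E
  falsified-axiom nt (unitAx (D , _) D∈F C≈) C-false =
    D , D∈F , C-false _ (ListClause-∋ C≈ (here refl))
  falsified-axiom nt (litPos x P N P≈x N≈x̄ C≈) C-false =
    ⊥-elim (nt x (C-false _ (ListClause-∋ C≈ (here refl)) _ (ListClause-∋ P≈x (here refl)))
                 (C-false _ (ListClause-∋ C≈ (there (here refl))) _ (ListClause-∋ N≈x̄ (here refl))))
  falsified-axiom nt (litNeg x P N P≈x N≈x̄ C≈) C-false
    with C-false _ (ListClause-∋ C≈ (here refl)) | C-false _ (ListClause-∋ C≈ (there (here refl)))
  ... | l , l∈P , l̄∈E | l′ , l′∈N , l̄′∈E
    with refl ← ListClause-unit l P≈x l∈P | refl ← ListClause-unit l′ N≈x̄ l′∈N =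
    ⊥-elim (nt x l̄′∈E l̄∈E)
  falsified-axiom {E} nt (orDef₁ A B D D≈A∪B C≈) C-false with C-false _ (ListClause-∋ C≈ (here refl))
  ... | l , l∈D , l̄∈E = ⊥-elim (NonTautological-neg E nt l l∈E l̄∈E)
    where
    A⊆E : ⟦ proj₁ A ⟧ ⊆ E
    A⊆E = C-false _ (ListClause-∋ C≈ (there (here refl)))
    B⊆E : ⟦ proj₁ B ⟧ ⊆ E
    B⊆E = C-false _ (ListClause-∋ C≈ (there (there (here refl))))
    l∈E : E ∋ₗ l
    l∈E = [ A⊆E l , B⊆E l ]′ (∪-∋⁻ ⟦ proj₁ A ⟧ ⟦ proj₁ B ⟧ l (trans (sym (D≈A∪B l)) l∈D))
  falsified-axiom {E} nt (orDef₂ A B D D≈A∪B C≈) C-false with C-false _ (ListClause-∋ C≈ (here refl))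
  ... | l , l∈A , l̄∈E = ⊥-elim (NonTautological-neg E nt l (D⊆E l l∈D) l̄∈E)
    where
    D⊆E : ⟦ proj₁ D ⟧ ⊆ E
    D⊆E = C-false _ (ListClause-∋ C≈ (there (here refl)))
    l∈D : ⟦ proj₁ D ⟧ ∋ₗ l
    l∈D = trans (D≈A∪B l) (∪-⊇ˡ ⟦ proj₁ A ⟧ ⟦ proj₁ B ⟧ l l∈A)
  falsified-axiom {E} nt (orDef₃ A B D D≈A∪B C≈) C-false with C-false _ (ListClause-∋ C≈ (here refl))
  ... | l , l∈B , l̄∈E = ⊥-elim (NonTautological-neg E nt l (D⊆E l l∈D) l̄∈E)
    where
    D⊆E : ⟦ proj₁ D ⟧ ⊆ E
    D⊆E = C-false _ (ListClause-∋ C≈ (there (here refl)))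
    l∈D : ⟦ proj₁ D ⟧ ∋ₗ l
    l∈D = trans (D≈A∪B l) (∪-⊇ʳ ⟦ proj₁ A ⟧ ⟦ proj₁ B ⟧ l l∈B)

  yIndices : List (Lit Y) → List (Fin n)
  yIndices = concatMap (λ l → indices (proj₁ (proj₁ l)))

  length-yIndices : ∀ L → length (yIndices L) ≤ length L * K
  length-yIndices []      = ≤-refl
  length-yIndices (l ∷ L) = ≤-trans (≤-reflexive (length-++ (indices (proj₁ (proj₁ l)))))
                                    (+-mono-≤ (length-indices-≤ (proj₁ l)) (length-yIndices L))

  narrow : List (Lit Y) → Clause (Var n m) → Clause (Var n m)
  narrow L E = E ∩ onIndices (yIndices L)

  ∈-narrow : ∀ {L D b} E l → E ∋ₗ l → (D , b) ∈ L → index l ∈ indices (proj₁ D) → narrow L E ∋ₗ l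
  ∈-narrow {L} E l l∈E Dᵇ∈L i∈D =
    ∩-∋⁺ E (onIndices (yIndices L)) l l∈E (onIndices-∋⁺ (yIndices L) l (∈-concatMap⁺ _ (lose Dᵇ∈L i∈D)))

  narrow-LiftedFalse : ∀ {C : Clause Y} {L E} → Every (_∈ L) C → Every (LiftedFalse E) C →
                       Every (LiftedFalse (narrow L E)) C
  narrow-LiftedFalse {E = E} C⊆L C-false ((D , _) , true) l∈C l′ l′∈D =
    ∈-narrow E l′ (C-false _ l∈C l′ l′∈D) (C⊆L _ l∈C) (index-∈-indices D l′ l′∈D)
  narrow-LiftedFalse {E = E} C⊆L C-false ((D , _) , false) l∈C with C-false _ l∈C
  ... | l′ , l′∈D , l̄′∈E = l′ , l′∈D , ∈-narrow E (neg l′) l̄′∈E (C⊆L _ l∈C) (index-∈-indices D l′ l′∈D)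

  simulate : ∀ {d C E} → Derivation (F′ F) (WidthAtMost w) d C → NonTautological E →
             Every (LiftedFalse E) C → DerivesSubclause (d * T) E

  simulateNarrow : ∀ {d C E J} → Derivation (F′ F) (WidthAtMost w) d C →
                   length J ≤ w * K → E ⊆ onIndices J → NonTautological E →
                   Every (LiftedFalse E) C → DerivesSubclause (d * T) E

  simulate {E = E} δ nt C-false with root-ok δ
  ... | L , |L|≤w , C⊆L =
    weakenSub (∩-⊆ˡ E I)
      (simulateNarrow {J = yIndices L} δ (≤-trans (length-yIndices L) (*-monoˡ-≤ K |L|≤w)) (∩-⊆ʳ E I)
                      (NonTautological-⊆ E (∩-⊆ˡ E I) nt) (narrow-LiftedFalse C⊆L C-false))
    where I = onIndices (yIndices L)

  simulateNarrow {J = J} (axiom _ C∈F′) |J| E⊆J nt C-false =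
    let D , D∈F , D⊆E = falsified-axiom nt C∈F′ C-false
    in ⟦ D ⟧ , D⊆E , axiom (IndexWidthAtMost-onIndices J (≤-trans |J| wK≤[K+K]w) (⊆-trans D⊆E E⊆J))
                           (D , D∈F , λ _ → refl)
  simulateNarrow {suc d} {E = E} {J} (resolve y@(D , _) _ δ₁ δ₂ res) |J| E⊆J nt C-false =
    deepenSub (step-depth y d)
      (decideAll (IndexWidthAtMost-onIndices (J ++ indices D) |J++D|≤[K+K]w)
                 (blockVars m (indices D)) (blockVars-in-onIndices (indices D) J)
                 (⊆-trans E⊆J (onIndices-++ˡ J (indices D))) nt leaf)
    where
    |J++D|≤[K+K]w : length (J ++ indices D) ≤ (K + K) * w
    |J++D|≤[K+K]w = ≤-trans (≤-reflexive (length-++ J))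
                     (≤-trans (+-mono-≤ |J| (length-indices-≤ y))
                              (wK+K≤[K+K]w (WidthAtMost-∋ (root-ok δ₁) (proj₁ res))))

    leaf : ∀ {E′} → E ⊆ E′ → NonTautological E′ → Decides (blockVars m (indices D)) E′ →
           DerivesSubclause (d * T) E′
    leaf {E′} E⊆E′ nt′ dec with satisfied-or-falsified _ (var-∈-blockVars D) dec
    ... | inj₁ D-sat =
      simulate δ₂ nt′ (resolvent-right (LiftedFalse E′) res (LiftedFalse-⊆ E⊆E′ C-false) D-sat)
    ... | inj₂ D-fal =
      simulate δ₁ nt′ (resolvent-left (LiftedFalse E′) res (LiftedFalse-⊆ E⊆E′ C-false) D-fal)

  refute : ∀ {d C} → IsEmpty C → Derivation (F′ F) (WidthAtMost w) d C →
           Refutation (asCNF F) (IndexWidthAtMost ((K + K) * w)) ((K + K) * d * suc m)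
  refute {d} C-empty δ with simulate {E = ∅} δ (λ _ ()) (IsEmpty-Every C-empty)
  ... | S , S⊆∅ , δ′ = S , ⊆∅⇒IsEmpty S⊆∅ , deepen (≤-reflexive d*T≡) δ′
    where
    d*T≡ : d * T ≡ (K + K) * d * suc m
    d*T≡ = trans (sym (*-assoc d (K + K) (suc m))) (cong (_* suc m) (*-comm d (K + K)))

proposition6 : ∀ (K : ℕ) → ∃[ c ] (∀ (s n : ℕ) (F : List (CClause n ⌈log₂ s ⌉)) →
                 formulaIndexWidth F ≤ K →
                 ∀ (w d : ℕ) → Refutation (F′ F) (WidthAtMost w) d →
                 Refutation (asCNF F) (IndexWidthAtMost (c * w)) (c * d * suc ⌈log₂ s ⌉))
proposition6 K = K + K , λ s n F k≤K w d (C , C-empty , δ) → Simulation.refute F K k≤K w C-empty δ
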